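{- Let $U$ be a row-strict composition tableau and $b$ a positive integer. Then each row of $U'=U\leftarrow b$ contains at most one box of the insertion path $I(b)$.
   Context: Diagrams: row $i$ of the diagram of a strong composition $\alpha$ has $\alpha_i$ left-justified boxes; $(i,j)$ is row $i$ (from the top), column $j$. A row-strict composition tableau (RCT) of shape $\alpha$ ($k$ parts, largest part $m$) is a filling with positive integers such that the first column weakly increases top to bottom, each row strictly decreases left to right, and (Triple Rule) after padding rows with zeros to a $k\times m$ array $\hat U$, for $1\le i_1<i_2\le k$, $2\le j\le m$: $\hat U(i_2,j)\neq0$ and $\hat U(i_2,j)>\hat U(i_1,j)$ imply $\hat U(i_2,j)\ge\hat U(i_1,j-1)$. RCT insertion $U\leftarrow b$ ($U$ an RCT with longest row length $m$, $b$ a positive integer): scan $U$ column by column from right to left, each column from top to bottom, starting in column $m+1$ with $b$ in hand. (1) In column $m+1$: if the current position is at the end of a row of length $m$ and $b$ is strictly less than the last entry of that row, place $b$ there and stop; otherwise continue at the top of column $m$. (2) Inductively, with entry $b_j$ in hand at the top of column $j$: (a) if the current position is empty, is at the end of a row of length $j-1$, and $b_j$ is strictly less than the last entry of that row, place $b_j$ there and stop; (b) if the current position is nonempty and holds $\tilde b_j\le b_j$ with $b_j$ strictly less than the entry immediately to the left of $\tilde b_j$, then $b_j$ replaces (bumps) $\tilde b_j$ and scanning of column $j$ continues with $\tilde b_j$ in hand, bumping whenever possible; after the last entry of column $j$, scanning continues at the top of column $j-1$. (3) If an entry $b_1$ is bumped into the first column, it is placed in a new row of length one that appears directly after the lowest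 row whose first-column entry is weakly less than $b_1$. The insertion path $I(b)$ is the set of boxes of $U\leftarrow b$ containing an entry placed during the algorithm (boxes where bumps occurred together with the newly created box). -}

module Defs where

open import Data.Nat using (ℕ; zero; suc; _+_; _∸_; _≤_; _<_; _>_; _⊔_; _≤ᵇ_; _<ᵇ_; _≡ᵇ_)
open import Data.Bool using (Bool; true; false; if_then_else_; _∧_)
open import Data.Maybe using (Maybe; just; nothing)
open import Data.List using (List; []; _∷_; [_]; _++_; length; map; foldr; take; drop)
open import Data.List.Relation.Unary.All using (All)
open import Data.List.Relation.Unary.Linked using (Linked)
open import Data.Product using (_×_; _,_)
open import Relation.Binary.PropositionalEquality using (_≢_)

-- Tableaux: a list of rows (top to bottom); each row lists its entries
-- left to right.  Rows are indexed 1,2,... from the top, columns 1,2,...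
-- from the left.

Row : Set
Row = List ℕ

Tableau : Set
Tableau = List Row

-- A box position (row , column), both 1-indexed.
Pos : Set
Pos = ℕ × ℕ

at : Row → ℕ → Maybe ℕ
at []       _             = nothing
at (x ∷ xs) zero          = nothing
at (x ∷ xs) (suc zero)    = just x
at (x ∷ xs) (suc (suc j)) = at xs (suc j)

-- j-th entry of a row, padded with 0 (the array \hat U).
at0 : Row → ℕ → ℕ
at0 r j with at r j
... | just x  = x
... | nothing = 0

hat : Tableau → ℕ → ℕ → ℕ
hat []       _             j = 0
hat (r ∷ rs) zero          j = 0
hat (r ∷ rs) (suc zero)    j = at0 r j
hat (r ∷ rs) (suc (suc i)) j = hat rs (suc i) j

numRows : Tableau → ℕ
numRows = length

maxLen : Tableau → ℕ
maxLen T = foldr _⊔_ 0 (map length T)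

record IsRCT (U : Tableau) : Set where
  field
    -- the shape is a strong composition: every row is nonempty
    rowsNonempty : All (λ r → 1 ≤ length r) U
    positive     : All (All (λ x → 1 ≤ x)) U
    firstCol     : Linked _≤_ (map (λ r → at0 r 1) U)
    rowStrict    : All (Linked _>_) U
    triple       : ∀ i₁ i₂ j → 1 ≤ i₁ → i₁ < i₂ → i₂ ≤ numRows U →
                   2 ≤ j → j ≤ maxLen U →
                   hat U i₂ j ≢ 0 → hat U i₁ j < hat U i₂ j →
                   hat U i₁ (j ∸ 1) ≤ hat U i₂ j

placeable : ℕ → ℕ → Row → Bool
placeable j h r with at r j | at r (j ∸ 1)
... | nothing | just l = (length r ≡ᵇ (j ∸ 1)) ∧ (h <ᵇ l)
... | _       | _      = false

bumpable : ℕ → ℕ → Row → Maybe ℕ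
bumpable j h r with at r j | at r (j ∸ 1)
... | just t | just l = if (t ≤ᵇ h) ∧ (h <ᵇ l) then just t else nothing
... | _      | _      = nothing

replaceAt : Row → ℕ → ℕ → Row
replaceAt []       _             _ = []
replaceAt (x ∷ xs) zero          _ = x ∷ xs
replaceAt (x ∷ xs) (suc zero)    y = y ∷ xs
replaceAt (x ∷ xs) (suc (suc j)) y = x ∷ replaceAt xs (suc j) y

data Hand : Set where
  stop  : Hand
  carry : ℕ → Hand

-- Scan column j top to bottom, starting at row i with h in hand.
scanCol : ℕ → ℕ → ℕ → Tableau → Tableau × List Pos × Hand
scanCol j i h [] = [] , [] , carry h
scanCol j i h (r ∷ rs) with placeable j h r
... | true  = (r ++ [ h ]) ∷ rs , [ (i , j) ] , stop
... | false with bumpable j h r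
...   | just t with scanCol j (suc i) t rs
...     | rs' , p , res = replaceAt r j h ∷ rs' , (i , j) ∷ p , res
scanCol j i h (r ∷ rs) | false | nothing with scanCol j (suc i) h rs
...     | rs' , p , res = r ∷ rs' , p , res

-- scanCols k h T scans columns k+2, k+1, ..., 2 (right to left).
scanCols : ℕ → ℕ → Tableau → Tableau × List Pos × Hand
scanCols k h T with scanCol (suc (suc k)) 1 h T
scanCols k h T | T' , p , stop = T' , p , stop
scanCols zero h T | T' , p , carry h' = T' , p , carry h'
scanCols (suc k) h T | T' , p , carry h' with scanCols k h' T'
... | T'' , p' , res = T'' , p ++ p' , res

scanFrom : ℕ → ℕ → Tableau → Tableau × List Pos × Hand
scanFrom zero          h T = T , [] , carry h
scanFrom (suc zero)    h T = T , [] , carry h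
scanFrom (suc (suc k)) h T = scanCols k h T

-- index (1-indexed) of the lowest row whose first entry is ≤ b, or 0 if none
lowestLE : ℕ → ℕ → ℕ → Tableau → ℕ
lowestLE b i acc []       = acc
lowestLE b i acc (r ∷ rs) = lowestLE b (suc i) (if at0 r 1 ≤ᵇ b then i else acc) rs

-- shift row indices ≥ n down by one (a new row was inserted at index n)
shiftFrom : ℕ → Pos → Pos
shiftFrom n (i , j) = if n ≤ᵇ i then (suc i , j) else (i , j)

-- U ← b together with its insertion path I(b) (as boxes of U ← b).
insertRCT : Tableau → ℕ → Tableau × List Pos
insertRCT U b with scanFrom (suc (maxLen U)) b U
... | T' , p , stop     = T' , p
... | T' , p , carry b₁ =
  let r = lowestLE b₁ 1 0 T'
  in take r T' ++ [ b₁ ] ∷ drop r T' , map (shiftFrom (suc r)) p ++ [ (suc r , 1) ]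

module Submission where

-- We show that the row indices of I(b) are pairwise distinct; only the strict
-- decrease of the rows of U is used.  Within a column the scan moves strictly
-- downwards, so it meets each row once.  Across columns: when h bumps t out of
-- column c of row r, every entry of r left of column c exceeds h ≥ t, and r
-- reaches past column c - 1.  As the entry in hand only decreases, r is then
-- "blocked" for the rest of the scan: it can neither be bumped nor receive a
-- placement.  Finally, a new first-column row shifts the earlier path rows
-- injectively and occupies a row of its own.

open import Defs
open import Data.Nat using (ℕ; _≤_)
open import Data.Product using (proj₁; proj₂)
open import Data.List.Membership.Propositional using (_∈_)
open import Relation.Binary.PropositionalEquality using (_≡_)

open import Data.Nat using (zero; suc; _<_; _>_; _∸_; _≤ᵇ_; _<ᵇ_; z≤n; s≤s; >-nonZero)
open import Data.Nat.Properties
open import Data.Bool using (true; false; if_then_else_; T; _∧_)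
open import Data.Bool.Properties using (T-≡; T-∧)
open import Data.Maybe using (just; nothing)
open import Data.List using (List; []; _∷_; [_]; _++_; length; map)
open import Data.List.Properties using (map-++)
open import Data.List.Relation.Unary.All as All using (All; []; _∷_)
open import Data.List.Relation.Unary.Linked as Linked using (Linked; _∷_)
open import Data.List.Relation.Unary.Any using (here; there)
open import Data.List.Relation.Unary.Unique.Propositional using (Unique; []; _∷_)
import Data.List.Relation.Unary.Unique.Propositional.Properties as Unique
open import Data.List.Relation.Binary.Disjoint.Propositional using (Disjoint)
open import Data.List.Membership.Propositional using (_∉_)
open import Data.List.Membership.Propositional.Properties
  using (∈-map⁺; ∈-map⁻; ∈-++⁻; ∈-++⁺ˡ; ∈-++⁺ʳ)
open import Data.Product using (_×_; _,_)
open import Data.Sum using (_⊎_; inj₁; inj₂)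
open import Data.Unit using (⊤; tt)
open import Data.Empty using (⊥-elim)
open import Function.Bundles using (Equivalence)
open import Relation.Nullary using (¬_; ofʸ; ofⁿ)
open import Relation.Binary.PropositionalEquality using (_≢_; refl; sym; trans; cong; cong₂; subst; module ≡-Reasoning)

rows : List Pos → List ℕ
rows = map proj₁

pathOf : Tableau × List Pos × Hand → List Pos
pathOf out = proj₁ (proj₂ out)

tableauOf : Tableau × List Pos × Hand → Tableau
tableauOf = proj₁

handOf : Tableau × List Pos × Hand → Hand
handOf out = proj₂ (proj₂ out)

at-in-range : ∀ r c {x} → at r c ≡ just x → 1 ≤ c × c ≤ length r
at-in-range []      c             ()
at-in-range (y ∷ r) zero          ()
at-in-range (y ∷ r) (suc zero)    e = s≤s z≤n , s≤s z≤n
at-in-range (y ∷ r) (suc (suc c)) e = s≤s z≤n , s≤s (proj₂ (at-in-range r (suc c) e))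

length-replaceAt : ∀ r c y → length (replaceAt r c y) ≡ length r
length-replaceAt []      c             y = refl
length-replaceAt (x ∷ r) zero          y = refl
length-replaceAt (x ∷ r) (suc zero)    y = refl
length-replaceAt (x ∷ r) (suc (suc c)) y = cong suc (length-replaceAt r (suc c) y)

at-replaceAt : ∀ r c y k → k < c → at (replaceAt r c y) k ≡ at r k
at-replaceAt []      c             y k             lt      = refl
at-replaceAt (x ∷ r) zero          y k             ()
at-replaceAt (x ∷ r) (suc zero)    y zero          lt      = refl
at-replaceAt (x ∷ r) (suc zero)    y (suc k)       (s≤s ())
at-replaceAt (x ∷ r) (suc (suc c)) y zero          lt      = refl
at-replaceAt (x ∷ r) (suc (suc c)) y (suc zero)    lt      = refl
at-replaceAt (x ∷ r) (suc (suc c)) y (suc (suc k)) (s≤s lt) = at-replaceAt r (suc c) y (suc k) lt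

decreasing-at : ∀ r k c {x y} → Linked _>_ r → k ≤ c → at r k ≡ just x → at r c ≡ just y → y ≤ x
decreasing-at []          k             c             lk        le       ()   e₂
decreasing-at (z ∷ r)     zero          c             lk        le       ()   e₂
decreasing-at (z ∷ r)     (suc k)       zero          lk        ()       e₁   e₂
decreasing-at (z ∷ r)     (suc zero)    (suc zero)    lk        le       refl refl = ≤-refl
decreasing-at (z ∷ [])    (suc zero)    (suc (suc c)) lk        le       refl ()
decreasing-at (z ∷ w ∷ r) (suc zero)    (suc (suc c)) (z>w ∷ lk) le      refl e₂ =
  <⇒≤ (≤-<-trans (decreasing-at (w ∷ r) 1 (suc c) lk (s≤s z≤n) refl e₂) z>w)
decreasing-at (z ∷ r)     (suc (suc k)) (suc zero)    lk        (s≤s ()) e₁   e₂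
decreasing-at (z ∷ r)     (suc (suc k)) (suc (suc c)) lk        (s≤s le) e₁   e₂ =
  decreasing-at r (suc k) (suc c) (Linked.tail lk) le e₁ e₂

conjuncts : ∀ {a b} → (a ∧ b) ≡ true → T a × T b
conjuncts e = Equivalence.to T-∧ (Equivalence.from T-≡ e)

placeable-length : ∀ j h r → placeable j h r ≡ true → length r ≡ j ∸ 1
placeable-length j h r e  with at r j | at r (j ∸ 1)
placeable-length j h r e  | nothing | just l  = ≡ᵇ⇒≡ (length r) (j ∸ 1) (proj₁ (conjuncts e))
placeable-length j h r () | nothing | nothing
placeable-length j h r () | just _  | _

record Bump (j h : ℕ) (r : Row) (t : ℕ) : Set where
  field
    left        : ℕ
    at-bumped   : at r j ≡ just t
    at-left     : at r (j ∸ 1) ≡ just left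
    bumped≤hand : t ≤ h
    hand<left   : h < left

bump-data : ∀ j h r {t} → bumpable j h r ≡ just t → Bump j h r t
bump-data j h r e with at r j in at-j | at r (j ∸ 1) in at-l
bump-data j h r e  | just t | just l with (t ≤ᵇ h) ∧ (h <ᵇ l) in tests
bump-data j h r refl | just t | just l | true = record
  { left = l ; at-bumped = at-j ; at-left = at-l
  ; bumped≤hand = ≤ᵇ⇒≤ t h (proj₁ (conjuncts tests))
  ; hand<left   = <ᵇ⇒< h l (proj₂ (conjuncts tests)) }
bump-data j h r () | just t  | just l  | false
bump-data j h r () | just t  | nothing
bump-data j h r () | nothing | _

record Blocked (c h : ℕ) (r : Row) : Set where
  constructor blocked
  field
    longer : c < length r
    larger : ∀ {k x} → k ≤ c → at r k ≡ just x → h < x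

blocked-weaken : ∀ {c c′ h h′ r} → Blocked c h r → c′ ≤ c → h′ ≤ h → Blocked c′ h′ r
blocked-weaken (blocked longer larger) c′≤c h′≤h =
  blocked (≤-<-trans c′≤c longer) (λ k≤c′ e → ≤-<-trans h′≤h (larger (≤-trans k≤c′ c′≤c) e))

blocked-no-bump : ∀ {c h r t} → Blocked c h r → bumpable c h r ≢ just t
blocked-no-bump {c} {h} {r} (blocked _ larger) e =
  <⇒≱ (larger ≤-refl (Bump.at-bumped bump)) (Bump.bumped≤hand bump)
  where bump = bump-data c h r e

blocked-no-place : ∀ {c h r} → Blocked c h r → placeable c h r ≢ true
blocked-no-place {c} {h} {r} (blocked longer _) e =
  <-irrefl (sym (placeable-length c h r e)) (≤-<-trans (m∸n≤m c 1) longer)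

bump-blocks : ∀ {c h r t h′} → Linked _>_ r → bumpable c h r ≡ just t → h′ ≤ t →
              Blocked (c ∸ 1) h′ (replaceAt r c h)
bump-blocks {c} {h} {r} {t} {h′} decreasing e h′≤t = blocked longer larger
  where
  open Bump (bump-data c h r e)
  column-bounds : 1 ≤ c × c ≤ length r
  column-bounds = at-in-range r c at-bumped
  c∸1<c : c ∸ 1 < c
  c∸1<c = m≤pred[n]⇒suc[m]≤n {{>-nonZero (proj₁ column-bounds)}} ≤-refl
  longer : c ∸ 1 < length (replaceAt r c h)
  longer rewrite length-replaceAt r c h = <-≤-trans c∸1<c (proj₂ column-bounds)
  larger : ∀ {k x} → k ≤ c ∸ 1 → at (replaceAt r c h) k ≡ just x → h′ < x
  larger {k} k≤ e′ =
    let unchanged = trans (sym (at-replaceAt r c h k (≤-<-trans k≤ c∸1<c))) e′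
    in ≤-<-trans h′≤t (≤-<-trans bumped≤hand
         (<-≤-trans hand<left (decreasing-at r k (c ∸ 1) decreasing k≤ unchanged at-left)))

RowStatus : ℕ → ℕ → List ℕ → ℕ → Row → Set
RowStatus c h P i r = (i ∈ P × Blocked c h r) ⊎ (i ∉ P × Linked _>_ r)

data Numbered (Q : ℕ → Row → Set) : ℕ → Tableau → Set where
  []  : ∀ {i} → Numbered Q i []
  _∷_ : ∀ {i r rs} → Q i r → Numbered Q (suc i) rs → Numbered Q i (r ∷ rs)

numbered-map : ∀ {Q Q′ : ℕ → Row → Set} {n rs} → (∀ {i r} → n ≤ i → Q i r → Q′ i r) →
               Numbered Q n rs → Numbered Q′ n rs
numbered-map f []       = []
numbered-map f (q ∷ qs) = f ≤-refl q ∷ numbered-map (λ n<i → f (<⇒≤ n<i)) qs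

initial-status : ∀ {c h i rs} → All (Linked _>_) rs → Numbered (RowStatus c h []) i rs
initial-status []                    = []
initial-status (decreasing ∷ others) = inj₂ ((λ ()) , decreasing) ∷ initial-status others

status-lower-hand : ∀ {c h h′ P i r} → h′ ≤ h → RowStatus c h P i r → RowStatus c h′ P i r
status-lower-hand h′≤h (inj₁ (used , b)) = inj₁ (used , blocked-weaken b ≤-refl h′≤h)
status-lower-hand h′≤h (inj₂ unused)     = inj₂ unused

status-mark-other : ∀ {c h P i j r} → i ≢ j → RowStatus c h P j r → RowStatus c h (i ∷ P) j r
status-mark-other i≢j (inj₁ (used , b))           = inj₁ (there used , b)
status-mark-other i≢j (inj₂ (unused , decreasing)) = inj₂ (unused′ , decreasing)
  where
  unused′ : _ ∉ _ ∷ _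
  unused′ (here j≡i) = i≢j (sym j≡i)
  unused′ (there m)  = unused m

status-next-column : ∀ {c h h′ P X i r} → h′ ≤ h → i ∉ X → RowStatus c h P i r →
                     RowStatus (c ∸ 1) h′ (X ++ P) i r
status-next-column {c} {X = X} h′≤h i∉X (inj₁ (used , b)) =
  inj₁ (∈-++⁺ʳ X used , blocked-weaken b (m∸n≤m c 1) h′≤h)
status-next-column {X = X} h′≤h i∉X (inj₂ (unused , decreasing)) = inj₂ (unused′ , decreasing)
  where
  unused′ : _ ∉ X ++ _
  unused′ m with ∈-++⁻ X m
  ... | inj₁ inX = i∉X inX
  ... | inj₂ inP = unused inP

unblocked : ∀ {c h P i r} → RowStatus c h P i r → ¬ Blocked c h r → i ∉ P × Linked _>_ r
unblocked (inj₁ (_ , b)) not-blocked = ⊥-elim (not-blocked b)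
unblocked (inj₂ unused)  not-blocked = unused

record FreshPath (P : List ℕ) (p : List Pos) : Set where
  constructor freshPath
  field
    unique   : Unique (rows p)
    disjoint : Disjoint (rows p) P

Continues : ℕ → ℕ → List ℕ → ℕ → Tableau → Hand → Set
Continues c h Q i rs stop        = ⊤
Continues c h Q i rs (carry h′) = h′ ≤ h × Numbered (RowStatus (c ∸ 1) h′ Q) i rs

record ColumnOK (c h : ℕ) (P : List ℕ) (i : ℕ) (out : Tableau × List Pos × Hand) : Set where
  constructor columnOK
  field
    fresh     : FreshPath P (pathOf out)
    below     : All (i ≤_) (rows (pathOf out))
    continues : Continues c h (rows (pathOf out) ++ P) i (tableauOf out) (handOf out)

fresh-[] : ∀ {P} → FreshPath P []
fresh-[] = freshPath [] λ { (() , _) }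

fresh-∷ : ∀ {P i j p} → i ∉ P → All (suc i ≤_) (rows p) → FreshPath P p → FreshPath P ((i , j) ∷ p)
fresh-∷ {i = i} i∉P below (freshPath unique disjoint) =
  freshPath (All.map (λ i<k i≡k → <-irrefl i≡k i<k) below ∷ unique) disjoint′
  where
  disjoint′ : Disjoint (i ∷ _) _
  disjoint′ (here refl , inP) = i∉P inP
  disjoint′ (there m   , inP) = disjoint (m , inP)

continues-after-bump : ∀ {c h P X i r rs t} res → Linked _>_ r → bumpable c h r ≡ just t →
  Continues c t (X ++ P) (suc i) rs res → Continues c h (i ∷ X ++ P) i (replaceAt r c h ∷ rs) res
continues-after-bump stop        decreasing e _ = tt
continues-after-bump {c} {h} {r = r} (carry h′) decreasing e (h′≤t , statuses) =
  ≤-trans h′≤t (Bump.bumped≤hand (bump-data c h r e)) ,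
  inj₁ (here refl , bump-blocks decreasing e h′≤t) ∷
  numbered-map (λ i<j → status-mark-other (<⇒≢ i<j)) statuses

continues-after-skip : ∀ {c h P X i r rs} res → RowStatus c h P i r → All (suc i ≤_) X →
  Continues c h (X ++ P) (suc i) rs res → Continues c h (X ++ P) i (r ∷ rs) res
continues-after-skip stop        status below _                    = tt
continues-after-skip (carry h′) status below (h′≤h , statuses) =
  h′≤h , status-next-column h′≤h (λ inX → <-irrefl refl (All.lookup below inX)) status ∷ statuses

scan-column : ∀ c i h rs P → Numbered (RowStatus c h P) i rs → ColumnOK c h P i (scanCol c i h rs)
scan-column c i h []       P []                  = columnOK fresh-[] [] (≤-refl , [])
scan-column c i h (r ∷ rs) P (status ∷ statuses) with placeable c h r in placed
... | true =
  columnOK (fresh-∷ (proj₁ untouched) [] fresh-[]) (≤-refl ∷ []) tt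
  where
  untouched : i ∉ P × Linked _>_ r
  untouched = unblocked status (λ b → blocked-no-place b placed)
... | false with bumpable c h r in bumped
...   | just t with scanCol c (suc i) t rs
                  | scan-column c (suc i) t rs P
                      (numbered-map (λ _ → status-lower-hand (Bump.bumped≤hand (bump-data c h r bumped)))
                                    statuses)
...     | rs′ , p , res | columnOK fresh below continues =
  columnOK (fresh-∷ (proj₁ untouched) below fresh) (≤-refl ∷ All.map <⇒≤ below)
           (continues-after-bump {X = rows p} res (proj₂ untouched) bumped continues)
  where
  untouched : i ∉ P × Linked _>_ r
  untouched = unblocked status (λ b → blocked-no-bump b bumped)
scan-column c i h (r ∷ rs) P (status ∷ statuses) | false | nothing
  with scanCol c (suc i) h rs | scan-column c (suc i) h rs P statuses
... | rs′ , p , res | columnOK fresh below continues =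
  columnOK fresh (All.map <⇒≤ below) (continues-after-skip {X = rows p} res status below continues)

fresh-++ : ∀ {P} p {p′} → FreshPath P p → FreshPath (rows p ++ P) p′ → FreshPath P (p ++ p′)
fresh-++ {P} p {p′} (freshPath unique disjoint) (freshPath unique′ disjoint′) =
  freshPath (subst Unique (sym split) (Unique.++⁺ unique unique′ separate)) joint
  where
  split : rows (p ++ p′) ≡ rows p ++ rows p′
  split = map-++ proj₁ p p′
  separate : Disjoint (rows p) (rows p′)
  separate (inX , inY) = disjoint′ (inY , ∈-++⁺ˡ inX)
  joint : Disjoint (rows (p ++ p′)) P
  joint (m , inP) with ∈-++⁻ (rows p) (subst (_ ∈_) split m)
  ... | inj₁ inX = disjoint (inX , inP)
  ... | inj₂ inY = disjoint′ (inY , ∈-++⁺ʳ (rows p) inP)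

scan-columns : ∀ k h T P → Numbered (RowStatus (suc (suc k)) h P) 1 T →
               FreshPath P (pathOf (scanCols k h T))
scan-columns k h T P statuses
  with scanCol (suc (suc k)) 1 h T | scan-column (suc (suc k)) 1 h T P statuses
scan-columns k       h T P statuses | T′ , p , stop      | columnOK fresh _ _ = fresh
scan-columns zero    h T P statuses | T′ , p , carry h′ | columnOK fresh _ _ = fresh
scan-columns (suc k) h T P statuses | T′ , p , carry h′ | columnOK fresh _ (_ , statuses′)
  with scanCols k h′ T′ | scan-columns k h′ T′ (rows p ++ P) statuses′
... | T″ , p′ , res | fresh′ = fresh-++ p fresh fresh′

scan-from-unique : ∀ n h T → All (Linked _>_) T → Unique (rows (pathOf (scanFrom n h T)))
scan-from-unique zero          h T decreasing = []
scan-from-unique (suc zero)    h T decreasing = []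
scan-from-unique (suc (suc k)) h T decreasing =
  FreshPath.unique (scan-columns k h T [] (initial-status decreasing))

shiftRow : ℕ → ℕ → ℕ
shiftRow n i = if n ≤ᵇ i then suc i else i

shiftFrom-row : ∀ n i j → proj₁ (shiftFrom n (i , j)) ≡ shiftRow n i
shiftFrom-row n i j with n ≤ᵇ i
... | true  = refl
... | false = refl

rows-shift : ∀ n p → rows (map (shiftFrom n) p) ≡ map (shiftRow n) (rows p)
rows-shift n []            = refl
rows-shift n ((i , j) ∷ p) = cong₂ _∷_ (shiftFrom-row n i j) (rows-shift n p)

shiftRow-cases : ∀ n i → (n ≤ i × shiftRow n i ≡ suc i) ⊎ (i < n × shiftRow n i ≡ i)
shiftRow-cases n i with n ≤ᵇ i | ≤ᵇ-reflects-≤ n i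
... | true  | ofʸ n≤i = inj₁ (n≤i , refl)
... | false | ofⁿ n≰i = inj₂ (≰⇒> n≰i , refl)

shifted-apart : ∀ {n i j} → n ≤ i → j < n → suc i ≢ j
shifted-apart {i = i} n≤i j<n si≡j = <-irrefl (sym si≡j) (<-≤-trans j<n (≤-trans n≤i (n≤1+n i)))

shiftRow-injective : ∀ n {i j} → shiftRow n i ≡ shiftRow n j → i ≡ j
shiftRow-injective n {i} {j} eq with shiftRow-cases n i | shiftRow-cases n j
... | inj₁ (_ , ei)     | inj₁ (_ , ej)     = suc-injective (trans (sym ei) (trans eq ej))
... | inj₁ (n≤i , ei)   | inj₂ (j<n , ej)   = ⊥-elim (shifted-apart n≤i j<n (trans (sym ei) (trans eq ej)))
... | inj₂ (i<n , ei)   | inj₁ (n≤j , ej)   = ⊥-elim (shifted-apart n≤j i<n (trans (sym ej) (trans (sym eq) ei)))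
... | inj₂ (_ , ei)     | inj₂ (_ , ej)     = trans (sym ei) (trans eq ej)

shiftRow-avoids : ∀ n i → shiftRow n i ≢ n
shiftRow-avoids n i hit with shiftRow-cases n i
... | inj₁ (n≤i , e) = <-irrefl (sym (trans (sym e) hit)) (s≤s n≤i)
... | inj₂ (i<n , e) = <-irrefl (trans (sym e) hit) i<n

shifted-path-unique : ∀ n p → Unique (rows p) → Unique (rows (map (shiftFrom n) p ++ [ (n , 1) ]))
shifted-path-unique n p unique =
  subst Unique (sym split) (Unique.++⁺ (Unique.map⁺ (shiftRow-injective n) unique) ([] ∷ []) avoids)
  where
  split : rows (map (shiftFrom n) p ++ [ (n , 1) ]) ≡ map (shiftRow n) (rows p) ++ [ n ]
  split = begin
    rows (map (shiftFrom n) p ++ [ (n , 1) ]) ≡⟨ map-++ proj₁ (map (shiftFrom n) p) [ (n , 1) ] ⟩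
    rows (map (shiftFrom n) p) ++ [ n ]       ≡⟨ cong (_++ [ n ]) (rows-shift n p) ⟩
    map (shiftRow n) (rows p) ++ [ n ]        ∎
    where open ≡-Reasoning
  avoids : Disjoint (map (shiftRow n) (rows p)) [ n ]
  avoids (m , here refl) with ∈-map⁻ (shiftRow n) m
  ... | i , _ , e = shiftRow-avoids n i (sym e)

insertion-path-rows-unique : ∀ U b → All (Linked _>_) U → Unique (rows (proj₂ (insertRCT U b)))
insertion-path-rows-unique U b decreasing
  with scanFrom (suc (maxLen U)) b U | scan-from-unique (suc (maxLen U)) b U decreasing
... | T′ , p , stop      | unique = unique
... | T′ , p , carry b₁ | unique = shifted-path-unique (suc (lowestLE b₁ 1 0 T′)) p unique

unique-keys : ∀ {A B : Set} (f : A → B) {xs x y} → Unique (map f xs) →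
              x ∈ xs → y ∈ xs → f x ≡ f y → x ≡ y
unique-keys f (_ ∷ _)     (here refl) (here refl) e = refl
unique-keys f (fresh ∷ _) (here refl) (there y∈)  e = ⊥-elim (All.lookup fresh (∈-map⁺ f y∈) e)
unique-keys f (fresh ∷ _) (there x∈)  (here refl) e = ⊥-elim (All.lookup fresh (∈-map⁺ f x∈) (sym e))
unique-keys f (_ ∷ rest)  (there x∈)  (there y∈)  e = unique-keys f rest x∈ y∈ e

mainTheorem3 : (U : Tableau) (b : ℕ) → IsRCT U → 1 ≤ b →
    ∀ p q → p ∈ proj₂ (insertRCT U b) → q ∈ proj₂ (insertRCT U b) →
    proj₁ p ≡ proj₁ q → p ≡ q
mainTheorem3 U b rct _ p q p∈ q∈ same-row =
  unique-keys proj₁ (insertion-path-rows-unique U b (IsRCT.rowStrict rct)) p∈ q∈ same-row
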